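{- Let $w$ be a word of length $n$ over the alphabet $\Sigma$. For every $h$ such that $0\le h\le\lfloor(n-1)/2\rfloor$, if $p$ is an integer such that $h<p<\max\{M_w[h],\lfloor(G_w[h]+1)/2\rfloor\}$, then $(h,p)$ is not an Abelian period of $w$.
   Context: Positions of $w$ start at 1; $w[i..j]$ is the factor from position $i$ to $j$; $|u|_a$ is the number of occurrences of letter $a$ in $u$; the Parikh vector of $u$ is $\mathcal{P}_u=(|u|_{a_1},\dots,|u|_{a_\sigma})$ with norm $|\mathcal{P}_u|$ the sum of its components; $\mathcal{P}_w(i,m)$ is the Parikh vector of the length-$m$ factor of $w$ starting at position $i$. For Parikh vectors, $\mathcal{P}\subset\mathcal{Q}$ means $\mathcal{P}[j]\le\mathcal{Q}[j]$ for all $j$ and $|\mathcal{P}|<|\mathcal{Q}|$. A word $w$ has Abelian period $(h,p)$ if $w=u_0u_1\cdots u_{k-1}u_k$ for some $k\ge2$ with $\mathcal{P}_{u_0}\subset\mathcal{P}_{u_1}=\cdots=\mathcal{P}_{u_{k-1}}\supset\mathcal{P}_{u_k}$, $|u_0|=h$, $|u_1|=p$. For $a\in\Sigma$, $i\ge1$, $\mathrm{select}_a(w,i)$ is the position of the $i$-th occurrence of $a$ in $w$ (undefined if there are fewer than $i$ occurrences), and $\mathrm{select}_a(w,0)=0$. For $0\le h\le\lfloor(n-1)/2\rfloor$: $M_w[h]=\min\{p\ge1 : h+p\le n,\ \mathcal{P}_w(1,h)\subset\mathcal{P}_w(h+1,p)\}$ if $2|w[1..h]|_a\le|w|_a$ for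 all $a\in\Sigma$, and $M_w[h]=-1$ otherwise; and $G_w[h]=\max\{\mathrm{select}_a(w,i+1)-\mathrm{select}_a(w,i) : a\in\Sigma,\ h<\mathrm{select}_a(w,i)<\mathrm{select}_a(w,i+1)\le n\}$ (taken to be $0$ if the set is empty). -}

module Defs where

open import Data.Nat using (ℕ; zero; suc; _+_; _*_; _∸_; _≤_; _<_; _≤?_; _<?_; _⊔_)
open import Data.Nat.DivMod using (_/_)
open import Data.Fin using (Fin) renaming (_≟_ to _≟ᶠ_)
open import Data.Fin.Properties using (all?)
open import Data.List using (List; []; _∷_; length; take; drop; _++_; concat; foldr; map; allFin; upTo)
open import Data.List.Relation.Unary.All using (All)
open import Data.Vec using (Vec; tabulate; lookup; sum)
open import Data.Maybe using (Maybe; just; nothing) renaming (map to mapMaybe)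
open import Data.Bool using (Bool; true; false; if_then_else_)
open import Data.Product using (Σ; _×_; _,_)
open import Data.Integer using (ℤ; +_; -[1+_])
open import Relation.Nullary using (Dec; yes; no; does)
open import Relation.Nullary.Decidable using (_×-dec_)
open import Relation.Binary.PropositionalEquality using (_≡_)

-- Words over the alphabet Σ = Fin σ; positions are 1-based.
Word : ℕ → Set
Word σ = List (Fin σ)

count : ∀ {σ} → Fin σ → Word σ → ℕ
count a [] = 0
count a (x ∷ xs) = if does (x ≟ᶠ a) then suc (count a xs) else count a xs

Parikh : ℕ → Set
Parikh σ = Vec ℕ σ

parikh : ∀ {σ} → Word σ → Parikh σ
parikh u = tabulate (λ a → count a u)

norm : ∀ {σ} → Parikh σ → ℕ
norm = sum

_⊂_ : ∀ {σ} → Parikh σ → Parikh σ → Set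
P ⊂ Q = (∀ j → lookup P j ≤ lookup Q j) × (norm P < norm Q)

_⊂?_ : ∀ {σ} (P Q : Parikh σ) → Dec (P ⊂ Q)
P ⊂? Q = all? (λ j → lookup P j ≤? lookup Q j) ×-dec (norm P <? norm Q)

prefix : ∀ {σ} → ℕ → Word σ → Word σ
prefix h w = take h w

parikhAt : ∀ {σ} → Word σ → ℕ → ℕ → Parikh σ
parikhAt w i m = parikh (take m (drop (i ∸ 1) w))

-- (h,p) is an Abelian period of w:
-- w = u0 u1 u2 ... u_{k-1} u_k with k ≥ 2 (here the middle blocks are u1 ∷ rest,
-- so k = 2 + length rest), P(u0) ⊂ P(u1) = ... = P(u_{k-1}) ⊃ P(u_k),
-- |u0| = h, |u1| = p.
AbelianPeriod : ∀ {σ} → Word σ → ℕ → ℕ → Set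
AbelianPeriod {σ} w h p =
  Σ (Word σ) λ u0 → Σ (Word σ) λ u1 → Σ (List (Word σ)) λ rest → Σ (Word σ) λ uk →
    (w ≡ u0 ++ u1 ++ concat rest ++ uk)
    × (length u0 ≡ h) × (length u1 ≡ p)
    × (parikh u0 ⊂ parikh u1)
    × All (λ u → parikh u ≡ parikh u1) rest
    × (parikh uk ⊂ parikh u1)

-- select_a(w,i): position of the i-th occurrence of a (select_a(w,0) = 0)
select : ∀ {σ} → Fin σ → Word σ → ℕ → Maybe ℕ
select a w zero = just 0
select a [] (suc i) = nothing
select a (x ∷ xs) (suc i) with does (x ≟ᶠ a)
... | true with i
...   | zero = just 1
...   | suc j = mapMaybe suc (select a xs (suc j))
select a (x ∷ xs) (suc i) | false = mapMaybe suc (select a xs (suc i))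

findMin : (P : ℕ → Set) → (∀ q → Dec (P q)) → ℕ → ℕ → Maybe ℕ
findMin P d s zero = nothing
findMin P d s (suc k) = if does (d s) then just s else findMin P d (suc s) k

MCond : ∀ {σ} → Word σ → ℕ → Set
MCond w h = ∀ a → 2 * count a (prefix h w) ≤ count a w

MCond? : ∀ {σ} (w : Word σ) h → Dec (MCond w h)
MCond? w h = all? (λ a → 2 * count a (prefix h w) ≤? count a w)

MSet : ∀ {σ} → Word σ → ℕ → ℕ → Set
MSet w h p = (h + p ≤ length w) × (parikhAt w 1 h ⊂ parikhAt w (h + 1) p)

MSet? : ∀ {σ} (w : Word σ) h p → Dec (MSet w h p)
MSet? w h p = (h + p ≤? length w) ×-dec (parikhAt w 1 h ⊂? parikhAt w (h + 1) p)

-- M_w[h] as an integer; the minimum is searched over p = 1 .. n - h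
-- (h + p ≤ n forces p ≤ n - h).  Under MCond and 2h < n the set is nonempty
-- (p = n - h belongs to it), so the `nothing` branch is unreachable in the
-- range of the theorem.
M : ∀ {σ} → Word σ → ℕ → ℤ
M w h with does (MCond? w h)
... | false = -[1+ 0 ]
... | true with findMin (MSet w h) (MSet? w h) 1 (length w ∸ h)
...   | just p = + p
...   | nothing = -[1+ 0 ]

maxL : List ℕ → ℕ
maxL = foldr _⊔_ 0

gapTerm : ∀ {σ} → Word σ → ℕ → Fin σ → ℕ → ℕ
gapTerm w h a i with select a w i | select a w (suc i)
... | just x | just y = if does (h <? x) then y ∸ x else 0
... | _ | _ = 0

-- G_w[h]: max over a and i ≥ 1 (i ≤ n suffices, as there are at most n
-- occurrences); all gaps are ≥ 1, so 0 exactly when the set is empty.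
-- (The condition select_a(w,i+1) ≤ n holds automatically.)
G : ∀ {σ} → Word σ → ℕ → ℕ
G w h = maxL (concat (map (λ a → map (λ i → gapTerm w h a (suc i)) (upTo (length w))) (allFin _)))

module Submission where

-- If (h,p) is an Abelian period of w = u₀u₁⋯u_{k-1}u_k, then both quantities
-- in max{M_w[h], ⌊(G_w[h]+1)/2⌋} are at most p, so no p below that maximum
-- can be an Abelian period.
--
--  * M_w[h] ≤ p: the block u₁ = w[h+1..h+p] itself witnesses
--    P_w(1,h) ⊂ P_w(h+1,p), and M_w[h] is the least such length.
--  * G_w[h] ≤ 2p: after position h the word is u₁⋯u_{k-1}u_k, a sequence
--    of blocks of length p containing every letter a equally often,
--    followed by a shorter tail with no more a's.  Any suffix of it that
--    still contains an a contains one within its first 2p letters (we say a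
--    "occurs within 2p"), so consecutive occurrences of a after position h
--    are at most 2p apart.

open import Defs
open import Data.Nat using (ℕ; _≤_; _<_; _∸_; _+_)
open import Data.Nat.DivMod using (_/_)
open import Data.Integer using (+_; _⊔_) renaming (_<_ to _<ℤ_)
open import Data.List using (length)
open import Relation.Nullary using (¬_)

open import Data.Nat using (zero; suc; _*_; z≤n; s≤s; _<ᵇ_; _≤?_)
open import Data.Nat.Properties
open import Data.Nat.DivMod using (m<n*o⇒m/o<n)
import Data.Integer as ℤ
import Data.Integer.Properties as ℤ
open import Data.Fin using (Fin) renaming (_≟_ to _≟ᶠ_; zero to fzero; suc to fsuc)
open import Data.List using (List; []; _∷_; take; drop; _++_; concat; upTo; allFin)
open import Data.List.Properties using (++-assoc; take-all; foldr-preservesᵇ)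
import Data.List.Properties as List
open import Data.List.Relation.Unary.All as All using (All; []; _∷_)
open import Data.List.Relation.Unary.All.Properties using (map⁺; concat⁺)
open import Data.Vec using (tabulate; lookup; sum)
open import Data.Bool using (true; false; if_then_else_)
open import Data.Sum using (inj₁; inj₂)
open import Data.Vec.Properties using (lookup∘tabulate)
open import Data.Maybe using (Maybe; just; nothing) renaming (map to mapMaybe)
open import Data.Product using (Σ; _×_; _,_; proj₂)
open import Data.Empty using (⊥-elim)
open import Relation.Nullary using (Dec; yes; no; does; ofʸ)
open import Relation.Binary.PropositionalEquality
  using (_≡_; refl; sym; trans; cong; cong₂; subst; subst₂; module ≡-Reasoning)

private variable
  σ : ℕ
  A : Set

take-++-length : (s t : List A) → take (length s) (s ++ t) ≡ s
take-++-length []      t = refl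
take-++-length (x ∷ s) t = cong (x ∷_) (take-++-length s t)

take-++ : (s t : List A) (n : ℕ) → take (length s + n) (s ++ t) ≡ s ++ take n t
take-++ []      t n = refl
take-++ (x ∷ s) t n = cong (x ∷_) (take-++ s t n)

drop-++ : (s t : List A) (n : ℕ) → drop (length s + n) (s ++ t) ≡ drop n t
drop-++ []      t n = refl
drop-++ (x ∷ s) t n = drop-++ s t n

drop-++-beyond : (s t : List A) (m : ℕ) → length s ≤ m → drop m (s ++ t) ≡ drop (m ∸ length s) t
drop-++-beyond s t m s≤m =
  trans (cong (λ k → drop k (s ++ t)) (sym (m+[n∸m]≡n s≤m))) (drop-++ s t (m ∸ length s))

drop-++-within : (s t : List A) (m : ℕ) → m ≤ length s → drop m (s ++ t) ≡ drop m s ++ t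
drop-++-within s       t zero    _         = refl
drop-++-within (x ∷ s) t (suc m) (s≤s m≤s) = drop-++-within s t m m≤s

count-++ : (a : Fin σ) (s t : Word σ) → count a (s ++ t) ≡ count a s + count a t
count-++ a []      t = refl
count-++ a (x ∷ s) t with x ≟ᶠ a
... | yes _ = cong suc (count-++ a s t)
... | no _  = count-++ a s t

count-take-mono : (a : Fin σ) {m n : ℕ} (t : Word σ) → m ≤ n → count a (take m t) ≤ count a (take n t)
count-take-mono a {zero}  t       _         = z≤n
count-take-mono a {suc m} []      _         = z≤n
count-take-mono a {suc m} (x ∷ t) (s≤s m≤n) with x ≟ᶠ a
... | yes _ = s≤s (count-take-mono a t m≤n)
... | no _  = count-take-mono a t m≤n

count-concat : (a : Fin σ) (c : ℕ) (bs : List (Word σ)) →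
  All (λ b → count a b ≡ c) bs → count a (concat bs) ≡ length bs * c
count-concat a c []       []          = refl
count-concat a c (b ∷ bs) (cb ∷ cbs) = begin
  count a (b ++ concat bs)          ≡⟨ count-++ a b (concat bs) ⟩
  count a b + count a (concat bs)   ≡⟨ cong₂ _+_ cb (count-concat a c bs cbs) ⟩
  c + length bs * c                 ∎
  where open ≡-Reasoning

parikh-lookup : (a : Fin σ) (u : Word σ) → lookup (parikh u) a ≡ count a u
parikh-lookup a u = lookup∘tabulate (λ b → count b u) a

sum-tabulate-zero : (σ : ℕ) → sum (tabulate {n = σ} (λ _ → 0)) ≡ 0
sum-tabulate-zero zero    = refl
sum-tabulate-zero (suc σ) = sum-tabulate-zero σ

-- Incrementing one component of a vector increments its sum; this is how
-- the Parikh vector changes when a letter x is prepended.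
sum-tabulate-bump : (x : Fin σ) (f : Fin σ → ℕ) →
  sum (tabulate (λ a → if does (x ≟ᶠ a) then suc (f a) else f a)) ≡ suc (sum (tabulate f))
sum-tabulate-bump fzero    f = refl
sum-tabulate-bump (fsuc x) f =
  trans (cong (_+_ (f fzero)) (sum-tabulate-bump x (λ a → f (fsuc a)))) (+-suc (f fzero) _)

parikh-norm : (u : Word σ) → norm (parikh u) ≡ length u
parikh-norm {σ} []  = sum-tabulate-zero σ
parikh-norm (x ∷ u) = trans (sum-tabulate-bump x (λ a → count a u)) (cong suc (parikh-norm u))

⊂⇒count-≤ : (u v : Word σ) → parikh u ⊂ parikh v → ∀ a → count a u ≤ count a v
⊂⇒count-≤ u v (le , _) a = subst₂ _≤_ (parikh-lookup a u) (parikh-lookup a v) (le a)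

⊂⇒length-< : (u v : Word σ) → parikh u ⊂ parikh v → length u < length v
⊂⇒length-< u v (_ , lt) = subst₂ _<_ (parikh-norm u) (parikh-norm v) lt

Block : Fin σ → ℕ → ℕ → Word σ → Set
Block a p c u = (length u ≡ p) × (count a u ≡ c)

parikh≡⇒Block : (a : Fin σ) (v : Word σ) {u : Word σ} → parikh u ≡ parikh v → Block a (length v) (count a v) u
parikh≡⇒Block a v {u} e =
    trans (sym (parikh-norm u)) (trans (cong norm e) (parikh-norm v))
  , trans (sym (parikh-lookup a u)) (trans (cong (λ P → lookup P a) e) (parikh-lookup a v))

OccursWithin : ℕ → Fin σ → Word σ → Set
OccursWithin d a t = 0 < count a t → 0 < count a (take d t)

occursWithin-short : (d : ℕ) (a : Fin σ) (t : Word σ) → length t ≤ d → OccursWithin d a t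
occursWithin-short d a t t≤d pos = subst (λ z → 0 < count a z) (sym (take-all d t t≤d)) pos

occursWithin-++ : (e d : ℕ) (a : Fin σ) (s r : Word σ) →
  length s ≤ e → OccursWithin d a r → OccursWithin (e + d) a (s ++ r)
occursWithin-++ e d a s r s≤e occ pos = <-≤-trans lower-pos window
  where
  window : count a s + count a (take d r) ≤ count a (take (e + d) (s ++ r))
  window = begin
    count a s + count a (take d r)            ≡⟨ count-++ a s (take d r) ⟨
    count a (s ++ take d r)                   ≡⟨ cong (count a) (take-++ s r d) ⟨
    count a (take (length s + d) (s ++ r))    ≤⟨ count-take-mono a (s ++ r) (+-monoˡ-≤ d s≤e) ⟩
    count a (take (e + d) (s ++ r))           ∎
    where open ≤-Reasoning
  lower-pos : 0 < count a s + count a (take d r)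
  lower-pos with count a s in cs
  ... | suc _ = s≤s z≤n
  ... | zero  = occ (subst (0 <_) (trans (count-++ a s r) (cong (_+ count a r) cs)) pos)

blocks-count-zero : (a : Fin σ) (p : ℕ) (bs : List (Word σ)) (uk : Word σ) →
  All (Block a p 0) bs → count a uk ≤ 0 → count a (concat bs ++ uk) ≡ 0
blocks-count-zero a p bs uk ok uk≤0 = begin
  count a (concat bs ++ uk)            ≡⟨ count-++ a (concat bs) uk ⟩
  count a (concat bs) + count a uk     ≡⟨ cong₂ _+_ (count-concat a 0 bs (All.map proj₂ ok)) (n≤0⇒n≡0 uk≤0) ⟩
  length bs * 0 + 0                    ≡⟨ cong (_+ 0) (*-zeroʳ (length bs)) ⟩
  0                                    ∎
  where open ≡-Reasoning

-- In blocks of length p with c a's each, followed by a tail of length ≤ p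
-- with ≤ c a's, the letter a occurs within p: either the first block
-- contains an a, or (c = 0) there is none at all.
occursWithin-blocks : (a : Fin σ) (p c : ℕ) (bs : List (Word σ)) (uk : Word σ) →
  All (Block a p c) bs → length uk ≤ p → count a uk ≤ c → OccursWithin p a (concat bs ++ uk)
occursWithin-blocks a p c [] uk [] uk≤p _ = occursWithin-short p a uk uk≤p
occursWithin-blocks a .(length b) c (b ∷ bs) uk ((refl , cb) ∷ ok) _ cuk pos
  rewrite ++-assoc b (concat bs) uk | take-++-length b (concat bs ++ uk) with c
... | suc _ = subst (0 <_) (sym cb) (s≤s z≤n)
... | zero  = ⊥-elim (<-irrefl (sym no-a) pos)
  where
  no-a : count a (b ++ concat bs ++ uk) ≡ 0
  no-a = subst (λ z → count a z ≡ 0) (++-assoc b (concat bs) uk)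
           (blocks-count-zero a (length b) (b ∷ bs) uk ((refl , cb) ∷ ok) cuk)

-- Every suffix of such a block sequence has a occurring within 2p: the
-- suffix is the rest of one block (≤ p letters) followed by whole blocks
-- and the tail, where a occurs within p.
occursWithin-suffix : (a : Fin σ) (p c : ℕ) (bs : List (Word σ)) (uk : Word σ) →
  All (Block a p c) bs → length uk ≤ p → count a uk ≤ c →
  ∀ m → OccursWithin (p + p) a (drop m (concat bs ++ uk))
occursWithin-suffix a p c [] uk [] uk≤p _ m =
  occursWithin-short (p + p) a (drop m uk) (begin
    length (drop m uk)   ≡⟨ List.length-drop m uk ⟩
    length uk ∸ m        ≤⟨ m∸n≤m (length uk) m ⟩
    length uk            ≤⟨ uk≤p ⟩
    p                    ≤⟨ m≤m+n p p ⟩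
    p + p                ∎)
  where open ≤-Reasoning
occursWithin-suffix a .(length b) c (b ∷ bs) uk ((refl , cb) ∷ ok) uk≤p cuk m
  rewrite ++-assoc b (concat bs) uk with length b ≤? m
... | yes b≤m =
  subst (OccursWithin (length b + length b) a) (sym (drop-++-beyond b _ m b≤m))
    (occursWithin-suffix a (length b) c bs uk ok uk≤p cuk (m ∸ length b))
... | no b≰m =
  subst (OccursWithin (length b + length b) a) (sym (drop-++-within b _ m m≤b))
    (occursWithin-++ (length b) (length b) a (drop m b) (concat bs ++ uk)
      (subst (_≤ length b) (sym (List.length-drop m b)) (m∸n≤m (length b) m))
      (occursWithin-blocks a (length b) c bs uk ok uk≤p cuk))
  where
  m≤b : m ≤ length b
  m≤b = <⇒≤ (≰⇒> b≰m)

map-suc≡just : (m : Maybe ℕ) {x : ℕ} → mapMaybe suc m ≡ just x → Σ ℕ λ x′ → (m ≡ just x′) × (x ≡ suc x′)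
map-suc≡just (just x′) refl = x′ , refl , refl

select-first-pos : (a : Fin σ) (t : Word σ) {y : ℕ} → select a t 1 ≡ just y → 0 < count a t
select-first-pos a (c ∷ t) e with c ≟ᶠ a
... | yes _ = s≤s z≤n
... | no _ with map-suc≡just (select a t 1) e
...   | _ , e′ , _ = select-first-pos a t e′

select-first-≤ : (a : Fin σ) (t : Word σ) (d : ℕ) {y : ℕ} →
  select a t 1 ≡ just y → OccursWithin d a t → y ≤ d
select-first-≤ a (c ∷ t) zero e occ with c ≟ᶠ a
... | yes _ with () ← occ (s≤s z≤n)
... | no _ with map-suc≡just (select a t 1) e
...   | _ , e′ , _ with () ← occ (select-first-pos a t e′)
select-first-≤ a (c ∷ t) (suc d) e occ with c ≟ᶠ a
... | yes _ with refl ← e = s≤s z≤n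
... | no _ with map-suc≡just (select a t 1) e
...   | _ , e′ , refl = s≤s (select-first-≤ a t d e′ occ)

select-gap-≤ : (a : Fin σ) (w : Word σ) (d i : ℕ) {x y : ℕ} →
  select a w (suc i) ≡ just x → select a w (suc (suc i)) ≡ just y →
  OccursWithin d a (drop x w) → y ∸ x ≤ d
select-gap-≤ a (c ∷ w) d i ex ey occ with c ≟ᶠ a
select-gap-≤ a (c ∷ w) d zero refl ey occ | yes _ with map-suc≡just (select a w 1) ey
... | _ , ey′ , refl = select-first-≤ a w d ey′ occ
select-gap-≤ a (c ∷ w) d (suc i) ex ey occ | yes _
  with map-suc≡just (select a w (suc i)) ex | map-suc≡just (select a w (suc (suc i))) ey
... | _ , ex′ , refl | _ , ey′ , refl = select-gap-≤ a w d i ex′ ey′ occ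
select-gap-≤ a (c ∷ w) d i ex ey occ | no _
  with map-suc≡just (select a w (suc i)) ex | map-suc≡just (select a w (suc (suc i))) ey
... | _ , ex′ , refl | _ , ey′ , refl = select-gap-≤ a w d i ex′ ey′ occ

maxL-≤ : (D : ℕ) (l : List ℕ) → All (_≤ D) l → maxL l ≤ D
maxL-≤ D l = foldr-preservesᵇ {P = _≤ D} ⊔-lub z≤n

gapTerm-≤ : (w : Word σ) (h D : ℕ) (a : Fin σ) →
  (∀ x → h < x → OccursWithin D a (drop x w)) → ∀ i → gapTerm w h a (suc i) ≤ D
gapTerm-≤ w h D a occ i with select a w (suc i) in ex | select a w (suc (suc i)) in ey
... | just x  | just y with h <ᵇ x | <ᵇ-reflects-< h x
...   | true  | ofʸ h<x = select-gap-≤ a w D i ex ey (occ x h<x)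
...   | false | _       = z≤n
gapTerm-≤ w h D a occ i | just _  | nothing = z≤n
gapTerm-≤ w h D a occ i | nothing | _       = z≤n

G-≤ : (w : Word σ) (h D : ℕ) → (∀ a x → h < x → OccursWithin D a (drop x w)) → G w h ≤ D
G-≤ {σ} w h D occ = maxL-≤ D _ (concat⁺ (map⁺ (All.universal (λ a →
  map⁺ (All.universal (gapTerm-≤ w h D a (occ a)) (upTo (length w)))) (allFin σ))))

findMin-≤ : (P : ℕ → Set) (P? : ∀ q → Dec (P q)) (s k p : ℕ) {q : ℕ} →
  findMin P P? s k ≡ just q → s ≤ p → P p → q ≤ p
findMin-≤ P P? s (suc k) p e s≤p Pp with P? s
findMin-≤ P P? s (suc k) p refl s≤p Pp | yes _ = s≤p
... | no ¬Ps with m≤n⇒m<n∨m≡n s≤p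
... | inj₁ s<p  = findMin-≤ P P? (suc s) k p e s<p Pp
... | inj₂ refl = ⊥-elim (¬Ps Pp)

M-≤ : (w : Word σ) (h p : ℕ) → 1 ≤ p → MSet w h p → M w h ℤ.≤ + p
M-≤ w h p 1≤p mset with does (MCond? w h)
... | false = ℤ.-≤+
... | true with findMin (MSet w h) (MSet? w h) 1 (length w ∸ h) in e
...   | just q  = ℤ.+≤+ (findMin-≤ (MSet w h) (MSet? w h) 1 (length w ∸ h) p e 1≤p mset)
...   | nothing = ℤ.-≤+

half-≤ : (g p : ℕ) → g ≤ p + p → (g + 1) / 2 ≤ p
half-≤ g p g≤2p = ≤-pred (m<n*o⇒m/o<n {n = suc p} {o = 2} (begin-strict
  g + 1          ≡⟨ +-comm g 1 ⟩
  suc g          ≤⟨ s≤s (subst (g ≤_) p+p≡p*2 g≤2p) ⟩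
  suc (p * 2)    <⟨ n<1+n _ ⟩
  suc p * 2      ∎))
  where
  open ≤-Reasoning
  p+p≡p*2 : p + p ≡ p * 2
  p+p≡p*2 = trans (cong (_+_ p) (sym (+-identityʳ p))) (*-comm 2 p)

prefix-factor : (u₀ t : Word σ) → parikhAt (u₀ ++ t) 1 (length u₀) ≡ parikh u₀
prefix-factor u₀ t = cong parikh (take-++-length u₀ t)

second-factor : (u₀ u₁ t : Word σ) → parikhAt (u₀ ++ u₁ ++ t) (length u₀ + 1) (length u₁) ≡ parikh u₁
second-factor u₀ u₁ t = cong parikh (begin
  take (length u₁) (drop (length u₀ + 1 ∸ 1) (u₀ ++ u₁ ++ t))  ≡⟨ cong (λ k → take (length u₁) (drop k (u₀ ++ u₁ ++ t))) (+-∸-assoc (length u₀) (s≤s z≤n)) ⟩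
  take (length u₁) (drop (length u₀ + 0) (u₀ ++ u₁ ++ t))      ≡⟨ cong (take (length u₁)) (drop-++ u₀ (u₁ ++ t) 0) ⟩
  take (length u₁) (u₁ ++ t)                                   ≡⟨ take-++-length u₁ t ⟩
  u₁                                                           ∎)
  where open ≡-Reasoning

abelianPeriod⇒M≤p : (w : Word σ) (h p : ℕ) → AbelianPeriod w h p → M w h ℤ.≤ + p
abelianPeriod⇒M≤p .(u₀ ++ u₁ ++ concat rest ++ uk) .(length u₀) .(length u₁)
  (u₀ , u₁ , rest , uk , refl , refl , refl , u₀⊂u₁ , _ , _) =
  M-≤ w (length u₀) (length u₁) (≤-trans (s≤s z≤n) (⊂⇒length-< u₀ u₁ u₀⊂u₁)) (fits , block-⊂)
  where
  t = concat rest ++ uk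
  w = u₀ ++ u₁ ++ t
  fits : length u₀ + length u₁ ≤ length w
  fits = begin
    length u₀ + length u₁                ≤⟨ +-monoʳ-≤ (length u₀) (m≤m+n (length u₁) (length t)) ⟩
    length u₀ + (length u₁ + length t)   ≡⟨ cong (_+_ (length u₀)) (List.length-++ u₁) ⟨
    length u₀ + length (u₁ ++ t)         ≡⟨ List.length-++ u₀ ⟨
    length w                             ∎
    where open ≤-Reasoning
  block-⊂ : parikhAt w 1 (length u₀) ⊂ parikhAt w (length u₀ + 1) (length u₁)
  block-⊂ = subst₂ _⊂_ (sym (prefix-factor u₀ (u₁ ++ t))) (sym (second-factor u₀ u₁ t)) u₀⊂u₁

abelianPeriod⇒G≤2p : (w : Word σ) (h p : ℕ) → AbelianPeriod w h p → G w h ≤ p + p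
abelianPeriod⇒G≤2p .(u₀ ++ u₁ ++ concat rest ++ uk) .(length u₀) .(length u₁)
  (u₀ , u₁ , rest , uk , refl , refl , refl , _ , rest≡u₁ , uk⊂u₁) =
  G-≤ (u₀ ++ u₁ ++ concat rest ++ uk) (length u₀) (length u₁ + length u₁) occurs
  where
  occurs : ∀ a x → length u₀ < x → OccursWithin (length u₁ + length u₁) a (drop x (u₀ ++ u₁ ++ concat rest ++ uk))
  occurs a x u₀<x =
    subst (OccursWithin (length u₁ + length u₁) a) (sym (drop-++-beyond u₀ _ x (<⇒≤ u₀<x)))
      (subst (λ z → OccursWithin (length u₁ + length u₁) a (drop (x ∸ length u₀) z))
        (++-assoc u₁ (concat rest) uk)
        (occursWithin-suffix a (length u₁) (count a u₁) (u₁ ∷ rest) uk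
          ((refl , refl) ∷ All.map (λ {u} → parikh≡⇒Block a u₁ {u}) rest≡u₁)
          (<⇒≤ (⊂⇒length-< uk u₁ uk⊂u₁)) (⊂⇒count-≤ uk u₁ uk⊂u₁ a) (x ∸ length u₀)))

-- Proposition 5.  An Abelian period (h,p) forces p ≥ M_w[h] and
-- p ≥ ⌊(G_w[h]+1)/2⌋.
proposition5 : ∀ {σ} (w : Word σ) (h p : ℕ) →
    1 ≤ length w → h ≤ (length w ∸ 1) / 2 →
    h < p → + p <ℤ (M w h ⊔ + ((G w h + 1) / 2)) →
    ¬ AbelianPeriod w h p
proposition5 w h p _ _ _ p<max period =
  ℤ.<⇒≱ p<max (ℤ.⊔-lub (abelianPeriod⇒M≤p w h p period)
                        (ℤ.+≤+ (half-≤ (G w h) p (abelianPeriod⇒G≤2p w h p period))))
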